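{- Let $G_1,G_2$ be undirected connected loopless multigraphs on vertex set $\{0,\dots,n\}$, $n\ge1$. Then $H_{Del_{G_1}}(O)=H_{Del_{G_2}}(O)$ if and only if $Q(G_1)=Q(G_2)$.
   Context: For such a multigraph $G$, $Q(G)=D(G)-A(G)$ is the Laplacian matrix (degree matrix minus adjacency matrix with edge multiplicities), with rows $b_0,\dots,b_n\in\mathbb{R}^{n+1}$. For a permutation $\sigma$ of $\{0,\dots,n\}$ put $u^\sigma_i=\sum_{j=0}^{i}b_{\sigma(j)}$ for $0\le i\le n$, let $\triangle_\sigma$ be the convex hull of $u^\sigma_0,\dots,u^\sigma_n$, and let $H_{Del_G}(O)=\bigcup_\sigma\triangle_\sigma$ over all permutations $\sigma$.
   Formalization: The set $H_{Del_G}(O)$ and the simplices $\triangle_\sigma$ are taken in ℚ^(n+1), with rational convex weights, instead of ℝ^(n+1). -}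

module Defs where

open import Data.Nat as ℕ using (ℕ; zero; suc)
open import Data.Integer as ℤ using (ℤ; +_)
open import Data.Rational as ℚ using (ℚ; 0ℚ; 1ℚ)
open import Data.Fin using (Fin; zero; suc; toℕ; _≟_)
open import Data.Fin.Permutation using (Permutation′; _⟨$⟩ʳ_)
open import Data.Product using (Σ; _×_; _,_)
open import Relation.Nullary using (yes; no)
open import Data.Bool using (if_then_else_)
open import Relation.Nullary.Decidable using (⌊_⌋)
open import Relation.Binary.PropositionalEquality using (_≡_)
open import Relation.Binary.Construct.Closure.ReflexiveTransitive using (Star)
open import Function.Bundles using (_⇔_)

sumℕ : ∀ {k} → (Fin k → ℕ) → ℕ
sumℕ {zero}  f = 0
sumℕ {suc k} f = f zero ℕ.+ sumℕ (λ i → f (suc i))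

sumℚ : ∀ {k} → (Fin k → ℚ) → ℚ
sumℚ {zero}  f = 0ℚ
sumℚ {suc k} f = f zero ℚ.+ sumℚ (λ i → f (suc i))

record Multigraph (n : ℕ) : Set where
  field
    mult      : Fin (suc n) → Fin (suc n) → ℕ
    symmetric : ∀ i j → mult i j ≡ mult j i
    loopless  : ∀ i → mult i i ≡ 0
open Multigraph public

Adj : ∀ {n} → Multigraph n → Fin (suc n) → Fin (suc n) → Set
Adj G i j = 1 ℕ.≤ mult G i j

Connected : ∀ {n} → Multigraph n → Set
Connected G = ∀ i j → Star (Adj G) i j

degree : ∀ {n} → Multigraph n → Fin (suc n) → ℕ
degree G i = sumℕ (λ j → mult G i j)

Laplacian : ∀ {n} → Multigraph n → Fin (suc n) → Fin (suc n) → ℤ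
Laplacian G i j with i ≟ j
... | yes _ = + degree G i
... | no  _ = ℤ.- (+ mult G i j)

Point : ℕ → Set
Point n = Fin (suc n) → ℚ

row : ∀ {n} → Multigraph n → Fin (suc n) → Point n
row G i k = Laplacian G i k ℚ./ 1

u : ∀ {n} → Multigraph n → Permutation′ (suc n) → Fin (suc n) → Point n
u G σ i k = sumℚ (λ j → if ⌊ toℕ j ℕ.≤? toℕ i ⌋ then row G (σ ⟨$⟩ʳ j) k else 0ℚ)

InConvexHull : ∀ {n} → (Fin (suc n) → Point n) → Point n → Set
InConvexHull {n} p x =
  Σ (Fin (suc n) → ℚ) λ λs →
    (∀ i → 0ℚ ℚ.≤ λs i) ×
    (sumℚ λs ≡ 1ℚ) ×
    (∀ k → x k ≡ sumℚ (λ i → λs i ℚ.* p i k))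

-- H_{Del_G}(O) = ⋃_σ △_σ, as a predicate on ℚ^{n+1}
H : ∀ {n} → Multigraph n → Point n → Set
H G x = Σ (Permutation′ _) λ σ → InConvexHull (u G σ) x

SameSet : ∀ {n} → (Point n → Set) → (Point n → Set) → Set
SameSet A B = ∀ x → A x ⇔ B x

-- Every vertex u^σ_i of H(G) is the sum of the rows b_s over s ∈ {σ(0), …, σ(i)}. Since the
-- off-diagonal entries of Q are ≤ 0 while Q_aa + Q_ak ≥ 0, such a sum has k-th coordinate at
-- most Q_kk and a-th plus k-th coordinate at most Q_aa + Q_ak + Q_ka + Q_kk (a ≠ k). These
-- linear bounds pass to the convex hulls, and they are attained by b_k = u^σ_0 and
-- b_a + b_k = u^σ_1 for suitable σ. Hence H(G) determines the diagonal of Q and, by symmetry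
-- of Q, also 2 Q_ak. Conversely H(G) is built from Q alone.

module Submission where

open import Defs
open import Data.Nat using (ℕ; _≤_)
open import Relation.Binary.PropositionalEquality using (_≡_)
open import Function.Bundles using (_⇔_)

open import Algebra.Bundles using (CommutativeMonoid; CommutativeRing)
import Algebra.Properties.Semiring.Sum as SemiringSum
open import Data.Bool using (Bool; true; false; if_then_else_)
open import Data.Empty using (⊥-elim)
open import Data.Fin using (Fin; zero; suc; toℕ; _≟_)
open import Data.Fin.Permutation
  using (Permutation′; _⟨$⟩ʳ_; _⟨$⟩ˡ_; flip; inverseʳ; transpose; _∘ₚ_)
open import Data.Integer as ℤ using (ℤ; +_; +≤+)
import Data.Integer.Properties as ℤP
import Data.Nat as ℕ
open import Data.Nat using (zero; suc; z≤n)
import Data.Nat.Coprimality as Coprime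
import Data.Nat.Properties as ℕP
open import Data.Product using (Σ; _×_; _,_)
open import Data.Rational as ℚ using (ℚ; 0ℚ; 1ℚ; mkℚ; *≤*)
import Data.Rational.Properties as ℚP
open import Function using (_∘_; case_of_)
open import Function.Bundles using (mk⇔; Equivalence)
open import Relation.Binary.Definitions using (tri<; tri≈; tri>)
open import Relation.Binary.PropositionalEquality
  using (refl; sym; trans; cong; cong₂; subst; subst₂; _≢_; _≗_; module ≡-Reasoning)
open import Relation.Nullary using (yes; no)
open import Relation.Nullary.Decidable using (⌊_⌋)

open import Algebra.Properties.CommutativeSemigroup
  (CommutativeMonoid.commutativeSemigroup ℚP.+-0-commutativeMonoid) using (interchange)
open ≡-Reasoning


module ℚSum = SemiringSum (CommutativeRing.semiring ℚP.+-*-commutativeRing)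

sumℚ≡sum : ∀ {m} (f : Fin m → ℚ) → sumℚ f ≡ ℚSum.sum f
sumℚ≡sum {zero}  f = refl
sumℚ≡sum {suc m} f = cong (f zero ℚ.+_) (sumℚ≡sum (λ i → f (suc i)))

sumℚ-cong : ∀ {m} {f g : Fin m → ℚ} → f ≗ g → sumℚ f ≡ sumℚ g
sumℚ-cong {zero}  f≗g = refl
sumℚ-cong {suc m} f≗g = cong₂ ℚ._+_ (f≗g zero) (sumℚ-cong (λ i → f≗g (suc i)))

sumℚ-mono-≤ : ∀ {m} {f g : Fin m → ℚ} → (∀ i → f i ℚ.≤ g i) → sumℚ f ℚ.≤ sumℚ g
sumℚ-mono-≤ {zero}  f≤g = ℚP.≤-refl
sumℚ-mono-≤ {suc m} f≤g = ℚP.+-mono-≤ (f≤g zero) (sumℚ-mono-≤ (λ i → f≤g (suc i)))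

sumℚ-zero : ∀ m → sumℚ {m} (λ _ → 0ℚ) ≡ 0ℚ
sumℚ-zero m = trans (sumℚ≡sum {m} (λ _ → 0ℚ)) (ℚSum.sum-replicate-zero m)

sumℚ-distrib-+ : ∀ {m} (f g : Fin m → ℚ) →
                 sumℚ (λ i → f i ℚ.+ g i) ≡ sumℚ f ℚ.+ sumℚ g
sumℚ-distrib-+ f g =
  trans (sumℚ≡sum (λ i → f i ℚ.+ g i))
        (trans (ℚSum.∑-distrib-+ f g) (sym (cong₂ ℚ._+_ (sumℚ≡sum f) (sumℚ≡sum g))))

sumℚ-*ʳ : ∀ {m} (f : Fin m → ℚ) c → sumℚ (λ i → f i ℚ.* c) ≡ sumℚ f ℚ.* c
sumℚ-*ʳ f c =
  trans (sumℚ≡sum (λ i → f i ℚ.* c))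
        (sym (trans (cong (ℚ._* c) (sumℚ≡sum f)) (ℚSum.*-distribʳ-sum c f)))

sumℚ-permute : ∀ {m} (f : Fin m → ℚ) (π : Permutation′ m) →
               sumℚ f ≡ sumℚ (λ i → f (π ⟨$⟩ʳ i))
sumℚ-permute f π =
  trans (sumℚ≡sum f)
        (trans (ℚSum.sum-permute f π) (sym (sumℚ≡sum (λ i → f (π ⟨$⟩ʳ i)))))

δ : ∀ {m} → Fin m → ℚ → Fin m → ℚ
δ i c j = if ⌊ j ≟ i ⌋ then c else 0ℚ

δ-suc : ∀ {m} (i : Fin m) c j → δ (suc i) c (suc j) ≡ δ i c j
δ-suc i c j with j ≟ i
... | yes _ = refl
... | no  _ = refl

sumℚ-δ : ∀ {m} (i : Fin m) c → sumℚ (δ i c) ≡ c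
sumℚ-δ {suc m} zero    c = trans (cong (c ℚ.+_) (sumℚ-zero m)) (ℚP.+-identityʳ c)
sumℚ-δ {suc m} (suc i) c =
  trans (cong (0ℚ ℚ.+_) (trans (sumℚ-cong (δ-suc i c)) (sumℚ-δ i c))) (ℚP.+-identityˡ c)

sumℚ-δ-* : ∀ {m} (i : Fin m) (f : Fin m → ℚ) → sumℚ (λ j → δ i 1ℚ j ℚ.* f j) ≡ f i
sumℚ-δ-* i f = trans (sumℚ-cong δ-*) (sumℚ-δ i (f i))
  where
  δ-* : ∀ j → δ i 1ℚ j ℚ.* f j ≡ δ i (f i) j
  δ-* j with j ≟ i
  ... | yes refl = ℚP.*-identityˡ (f j)
  ... | no  _    = ℚP.*-zeroˡ (f j)

δ-nonNeg : ∀ {m} (i : Fin m) {c} → 0ℚ ℚ.≤ c → ∀ j → 0ℚ ℚ.≤ δ i c j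
δ-nonNeg i 0≤c j with j ≟ i
... | yes _ = 0≤c
... | no  _ = ℚP.≤-refl

sumℚ-convex-≤ : ∀ {m} {λs y : Fin m → ℚ} {C} →
                (∀ i → 0ℚ ℚ.≤ λs i) → sumℚ λs ≡ 1ℚ → (∀ i → y i ℚ.≤ C) →
                sumℚ (λ i → λs i ℚ.* y i) ℚ.≤ C
sumℚ-convex-≤ {λs = λs} {C = C} λs≥0 Σλs≡1 y≤C = ℚP.≤-trans
  (sumℚ-mono-≤ (λ i → ℚP.*-monoˡ-≤-nonNeg (λs i) {{ℚ.nonNegative (λs≥0 i)}} (y≤C i)))
  (ℚP.≤-reflexive (trans (sumℚ-*ʳ λs C) (trans (cong (ℚ._* C) Σλs≡1) (ℚP.*-identityˡ C))))

sumOver : ∀ {m} → (Fin m → Bool) → (Fin m → ℚ) → ℚ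
sumOver S f = sumℚ (λ s → if S s then f s else 0ℚ)

sumOver-+ : ∀ {m} (S : Fin m → Bool) (f g : Fin m → ℚ) →
            sumOver S f ℚ.+ sumOver S g ≡ sumOver S (λ s → f s ℚ.+ g s)
sumOver-+ S f g =
  trans (sym (sumℚ-distrib-+ (λ s → if S s then f s else 0ℚ) (λ s → if S s then g s else 0ℚ)))
        (sumℚ-cong merge)
  where
  merge : ∀ s → (if S s then f s else 0ℚ) ℚ.+ (if S s then g s else 0ℚ)
              ≡ (if S s then f s ℚ.+ g s else 0ℚ)
  merge s with S s
  ... | true  = refl
  ... | false = ℚP.+-identityʳ 0ℚ

sumOver-permute : ∀ {m} (S : Fin m → Bool) (f : Fin m → ℚ) (σ : Permutation′ m) →
                  sumOver S (λ j → f (σ ⟨$⟩ʳ j)) ≡ sumOver (λ s → S (σ ⟨$⟩ˡ s)) f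
sumOver-permute S f σ = trans (sumℚ-permute (λ j → if S j then f (σ ⟨$⟩ʳ j) else 0ℚ) (flip σ))
  (sumℚ-cong (λ s → cong (λ t → if S (σ ⟨$⟩ˡ s) then f t else 0ℚ) (inverseʳ σ)))

sumOver-≤-sumℚ : ∀ {m} (S : Fin m → Bool) {f c : Fin m → ℚ} →
                 (∀ s → 0ℚ ℚ.≤ c s) → (∀ s → f s ℚ.≤ c s) → sumOver S f ℚ.≤ sumℚ c
sumOver-≤-sumℚ S {f} {c} c≥0 f≤c = sumℚ-mono-≤ term
  where
  term : ∀ s → (if S s then f s else 0ℚ) ℚ.≤ c s
  term s with S s
  ... | true  = f≤c s
  ... | false = c≥0 s

sumOver-≤-single : ∀ {m} (S : Fin m → Bool) {f : Fin m → ℚ} k →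
                   (∀ s → s ≢ k → f s ℚ.≤ 0ℚ) → 0ℚ ℚ.≤ f k → sumOver S f ℚ.≤ f k
sumOver-≤-single S {f} k f≤0 0≤fk = ℚP.≤-trans
  (sumOver-≤-sumℚ S (δ-nonNeg k 0≤fk) f≤δ) (ℚP.≤-reflexive (sumℚ-δ k (f k)))
  where
  f≤δ : ∀ s → f s ℚ.≤ δ k (f k) s
  f≤δ s with s ≟ k
  ... | yes refl = ℚP.≤-refl
  ... | no  s≢k  = f≤0 s s≢k

sumOver-≤-pair : ∀ {m} (S : Fin m → Bool) {f : Fin m → ℚ} a k → a ≢ k →
                 (∀ s → s ≢ a → s ≢ k → f s ℚ.≤ 0ℚ) → 0ℚ ℚ.≤ f a → 0ℚ ℚ.≤ f k →
                 sumOver S f ℚ.≤ f a ℚ.+ f k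
sumOver-≤-pair S {f} a k a≢k f≤0 0≤fa 0≤fk = ℚP.≤-trans
  (sumOver-≤-sumℚ S (λ s → ℚP.+-mono-≤ (δ-nonNeg a 0≤fa s) (δ-nonNeg k 0≤fk s)) f≤δ+δ)
  (ℚP.≤-reflexive (trans (sumℚ-distrib-+ (δ a (f a)) (δ k (f k)))
                         (cong₂ ℚ._+_ (sumℚ-δ a (f a)) (sumℚ-δ k (f k)))))
  where
  f≤δ+δ : ∀ s → f s ℚ.≤ δ a (f a) s ℚ.+ δ k (f k) s
  f≤δ+δ s with s ≟ a | s ≟ k
  ... | yes refl | yes refl = ⊥-elim (a≢k refl)
  ... | yes refl | no  _    = ℚP.≤-reflexive (sym (ℚP.+-identityʳ (f s)))
  ... | no  _    | yes refl = ℚP.≤-reflexive (sym (ℚP.+-identityˡ (f s)))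
  ... | no  s≢a  | no  s≢k  = ℚP.≤-trans (f≤0 s s≢a s≢k) (ℚP.≤-reflexive (sym (ℚP.+-identityʳ 0ℚ)))

-- Unlike x / 1, which goes through gcd normalisation, this fraction has numerator x on the nose.
fromℤ : ℤ → ℚ
fromℤ x = mkℚ x 0 (Coprime.sym (Coprime.1-coprimeTo _))

/1≡fromℤ : ∀ x → x ℚ./ 1 ≡ fromℤ x
/1≡fromℤ x = ℚP.↥p/↧p≡p (fromℤ x)

fromℤ-+ : ∀ x y → fromℤ x ℚ.+ fromℤ y ≡ fromℤ (x ℤ.+ y)
fromℤ-+ x y =
  trans (ℚP./-cong (cong₂ ℤ._+_ (ℤP.*-identityʳ x) (ℤP.*-identityʳ y)) refl) (/1≡fromℤ _)

fromℤ-mono-≤ : ∀ {x y} → x ℤ.≤ y → fromℤ x ℚ.≤ fromℤ y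
fromℤ-mono-≤ {x} {y} x≤y = *≤* (subst₂ ℤ._≤_ (sym (ℤP.*-identityʳ x)) (sym (ℤP.*-identityʳ y)) x≤y)

fromℤ-injective : ∀ {x y} → fromℤ x ≡ fromℤ y → x ≡ y
fromℤ-injective = cong ℚ.↥_

sumℕ-≥-term : ∀ {m} (f : Fin m → ℕ) j → f j ℕ.≤ sumℕ f
sumℕ-≥-term f zero    = ℕP.m≤m+n (f zero) _
sumℕ-≥-term f (suc j) = ℕP.≤-trans (sumℕ-≥-term (λ i → f (suc i)) j) (ℕP.m≤n+m _ (f zero))

module _ {n} (G : Multigraph n) where

  Laplacian-diagonal : ∀ i → Laplacian G i i ≡ + degree G i
  Laplacian-diagonal i with i ≟ i
  ... | yes _   = refl
  ... | no  i≢i = ⊥-elim (i≢i refl)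

  Laplacian-offDiagonal : ∀ {i j} → i ≢ j → Laplacian G i j ≡ ℤ.- (+ mult G i j)
  Laplacian-offDiagonal {i} {j} i≢j with i ≟ j
  ... | yes i≡j = ⊥-elim (i≢j i≡j)
  ... | no  _   = refl

  Laplacian-sym : ∀ i j → Laplacian G i j ≡ Laplacian G j i
  Laplacian-sym i j = case i ≟ j of λ where
    (yes refl) → refl
    (no i≢j)   → begin
      Laplacian G i j     ≡⟨ Laplacian-offDiagonal i≢j ⟩
      ℤ.- (+ mult G i j)  ≡⟨ cong (λ m → ℤ.- (+ m)) (symmetric G i j) ⟩
      ℤ.- (+ mult G j i)  ≡⟨ Laplacian-offDiagonal (i≢j ∘ sym) ⟨
      Laplacian G j i     ∎

  row≡fromℤ : ∀ i j → row G i j ≡ fromℤ (Laplacian G i j)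
  row≡fromℤ i j = /1≡fromℤ (Laplacian G i j)

  row-sym : ∀ i j → row G i j ≡ row G j i
  row-sym i j = cong (ℚ._/ 1) (Laplacian-sym i j)

  row-diagonal-nonNeg : ∀ i → 0ℚ ℚ.≤ row G i i
  row-diagonal-nonNeg i rewrite row≡fromℤ i i | Laplacian-diagonal i = fromℤ-mono-≤ (+≤+ z≤n)

  row-offDiagonal-nonPos : ∀ {i j} → i ≢ j → row G i j ℚ.≤ 0ℚ
  row-offDiagonal-nonPos {i} {j} i≢j rewrite row≡fromℤ i j | Laplacian-offDiagonal i≢j =
    fromℤ-mono-≤ (ℤP.neg-mono-≤ (+≤+ z≤n))

  row-diagonal+offDiagonal-nonNeg : ∀ {i j} → i ≢ j → 0ℚ ℚ.≤ row G i i ℚ.+ row G i j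
  row-diagonal+offDiagonal-nonNeg {i} {j} i≢j
    rewrite row≡fromℤ i i | row≡fromℤ i j | Laplacian-diagonal i | Laplacian-offDiagonal i≢j
          | fromℤ-+ (+ degree G i) (ℤ.- (+ mult G i j)) =
    fromℤ-mono-≤ (ℤP.i≤j⇒0≤j-i (+≤+ (sumℕ-≥-term (mult G i) j)))

row-injective : ∀ {n} (G₁ G₂ : Multigraph n) i j →
                row G₁ i j ≡ row G₂ i j → Laplacian G₁ i j ≡ Laplacian G₂ i j
row-injective G₁ G₂ i j eq =
  fromℤ-injective (trans (sym (row≡fromℤ G₁ i j)) (trans eq (row≡fromℤ G₂ i j)))

transpose-fixes : ∀ {m} {i j x : Fin m} → x ≢ i → x ≢ j → transpose i j ⟨$⟩ʳ x ≡ x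
transpose-fixes {i = i} {j} {x} x≢i x≢j with x ≟ i
... | yes x≡i = ⊥-elim (x≢i x≡i)
... | no  _ with x ≟ j
...   | yes x≡j = ⊥-elim (x≢j x≡j)
...   | no  _   = refl

permutation-starting-with : ∀ {m} {a k : Fin (suc (suc m))} → a ≢ k →
  Σ (Permutation′ (suc (suc m))) λ σ → σ ⟨$⟩ʳ zero ≡ a × σ ⟨$⟩ʳ suc zero ≡ k
permutation-starting-with {m} {a} {k} a≢k =
  transpose (suc zero) (ρ ⟨$⟩ˡ k) ∘ₚ ρ ,
  cong (ρ ⟨$⟩ʳ_) (transpose-fixes {i = suc zero} (λ ()) 0≢ρ⁻¹k) ,
  inverseʳ ρ
  where
  ρ : Permutation′ (suc (suc m))
  ρ = transpose zero a
  0≢ρ⁻¹k : zero ≢ ρ ⟨$⟩ˡ k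
  0≢ρ⁻¹k 0≡ρ⁻¹k = a≢k (trans (cong (ρ ⟨$⟩ʳ_) 0≡ρ⁻¹k) (inverseʳ ρ))

prefixOf : ∀ {m} → Permutation′ m → Fin m → Fin m → Bool
prefixOf σ i s = ⌊ toℕ (σ ⟨$⟩ˡ s) ℕ.≤? toℕ i ⌋

module _ {n} (G : Multigraph n) where

  blockSum : Fin (suc n) → Fin (suc n) → ℚ
  blockSum a k = (row G a a ℚ.+ row G a k) ℚ.+ (row G k a ℚ.+ row G k k)

  u≡sumOver-rows : ∀ σ i t → u G σ i t ≡ sumOver (prefixOf σ i) (λ s → row G s t)
  u≡sumOver-rows σ i t = sumOver-permute (λ j → ⌊ toℕ j ℕ.≤? toℕ i ⌋) (λ s → row G s t) σ

  u-coordinate-≤ : ∀ σ i k → u G σ i k ℚ.≤ row G k k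
  u-coordinate-≤ σ i k = ℚP.≤-trans (ℚP.≤-reflexive (u≡sumOver-rows σ i k))
    (sumOver-≤-single (prefixOf σ i) k (λ s → row-offDiagonal-nonPos G) (row-diagonal-nonNeg G k))

  u-coordinateSum-≤ : ∀ σ i {a k} → a ≢ k → u G σ i a ℚ.+ u G σ i k ℚ.≤ blockSum a k
  u-coordinateSum-≤ σ i {a} {k} a≢k = ℚP.≤-trans (ℚP.≤-reflexive u+u≡sumOver)
    (sumOver-≤-pair (prefixOf σ i) a k a≢k
                    column≤0 (row-diagonal+offDiagonal-nonNeg G a≢k) column-k≥0)
    where
    u+u≡sumOver : u G σ i a ℚ.+ u G σ i k ≡ sumOver (prefixOf σ i) (λ s → row G s a ℚ.+ row G s k)
    u+u≡sumOver = trans (cong₂ ℚ._+_ (u≡sumOver-rows σ i a) (u≡sumOver-rows σ i k))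
                        (sumOver-+ (prefixOf σ i) (λ s → row G s a) (λ s → row G s k))
    column≤0 : ∀ s → s ≢ a → s ≢ k → row G s a ℚ.+ row G s k ℚ.≤ 0ℚ
    column≤0 s s≢a s≢k = ℚP.≤-trans
      (ℚP.+-mono-≤ (row-offDiagonal-nonPos G s≢a) (row-offDiagonal-nonPos G s≢k))
      (ℚP.≤-reflexive (ℚP.+-identityʳ 0ℚ))
    column-k≥0 : 0ℚ ℚ.≤ row G k a ℚ.+ row G k k
    column-k≥0 = ℚP.≤-trans (row-diagonal+offDiagonal-nonNeg G (a≢k ∘ sym))
                            (ℚP.≤-reflexive (ℚP.+-comm (row G k k) (row G k a)))

  H-coordinate-≤ : ∀ {x} k → H G x → x k ℚ.≤ row G k k
  H-coordinate-≤ k (σ , λs , λs≥0 , Σλs≡1 , x≡) = ℚP.≤-trans (ℚP.≤-reflexive (x≡ k))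
    (sumℚ-convex-≤ λs≥0 Σλs≡1 (λ i → u-coordinate-≤ σ i k))

  H-coordinateSum-≤ : ∀ {x a k} → a ≢ k → H G x → x a ℚ.+ x k ℚ.≤ blockSum a k
  H-coordinateSum-≤ {x} {a} {k} a≢k (σ , λs , λs≥0 , Σλs≡1 , x≡) =
    ℚP.≤-trans (ℚP.≤-reflexive x+x≡combination)
      (sumℚ-convex-≤ λs≥0 Σλs≡1 (λ i → u-coordinateSum-≤ σ i a≢k))
    where
    x+x≡combination : x a ℚ.+ x k ≡ sumℚ (λ i → λs i ℚ.* (u G σ i a ℚ.+ u G σ i k))
    x+x≡combination = begin
      x a ℚ.+ x k
        ≡⟨ cong₂ ℚ._+_ (x≡ a) (x≡ k) ⟩
      sumℚ (λ i → λs i ℚ.* u G σ i a) ℚ.+ sumℚ (λ i → λs i ℚ.* u G σ i k)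
        ≡⟨ sumℚ-distrib-+ (λ i → λs i ℚ.* u G σ i a) (λ i → λs i ℚ.* u G σ i k) ⟨
      sumℚ (λ i → λs i ℚ.* u G σ i a ℚ.+ λs i ℚ.* u G σ i k)
        ≡⟨ sumℚ-cong (λ i → ℚP.*-distribˡ-+ (λs i) (u G σ i a) (u G σ i k)) ⟨
      sumℚ (λ i → λs i ℚ.* (u G σ i a ℚ.+ u G σ i k)) ∎

  H-resp-≗ : ∀ {x y} → x ≗ y → H G x → H G y
  H-resp-≗ x≗y (σ , λs , λs≥0 , Σλs≡1 , x≡) =
    σ , λs , λs≥0 , Σλs≡1 , (λ t → trans (sym (x≗y t)) (x≡ t))

  u∈H : ∀ σ i → H G (u G σ i)
  u∈H σ i = σ , δ i 1ℚ , δ-nonNeg i (fromℤ-mono-≤ (+≤+ z≤n)) , sumℚ-δ i 1ℚ ,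
            (λ t → sym (sumℚ-δ-* i (λ j → u G σ j t)))

  row∈H : ∀ k → H G (row G k)
  row∈H k = H-resp-≗ first (u∈H (transpose zero k) zero)
    where
    first : u G (transpose zero k) zero ≗ row G k
    first t = trans (cong (row G k t ℚ.+_) (sumℚ-zero n)) (ℚP.+-identityʳ (row G k t))

rowSum∈H : ∀ {n} (G : Multigraph (suc n)) {a k} → a ≢ k → H G (λ t → row G a t ℚ.+ row G k t)
rowSum∈H {n} G a≢k with permutation-starting-with a≢k
... | σ , refl , refl = H-resp-≗ G firstTwo (u∈H G σ (suc zero))
  where
  firstTwo : u G σ (suc zero) ≗ λ t → row G (σ ⟨$⟩ʳ zero) t ℚ.+ row G (σ ⟨$⟩ʳ suc zero) t
  firstTwo t = cong (row G (σ ⟨$⟩ʳ zero) t ℚ.+_)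
    (trans (cong (row G (σ ⟨$⟩ʳ suc zero) t ℚ.+_) (sumℚ-zero n)) (ℚP.+-identityʳ _))

middle-mono-< : ∀ x z {y y′} → y ℚ.< y′ →
                (x ℚ.+ y) ℚ.+ (y ℚ.+ z) ℚ.< (x ℚ.+ y′) ℚ.+ (y′ ℚ.+ z)
middle-mono-< x z y<y′ = ℚP.+-mono-< (ℚP.+-monoʳ-< x y<y′) (ℚP.+-monoˡ-< z y<y′)

middle-cancel : ∀ x z {y y′} → (x ℚ.+ y) ℚ.+ (y ℚ.+ z) ≡ (x ℚ.+ y′) ℚ.+ (y′ ℚ.+ z) → y ≡ y′
middle-cancel x z {y} {y′} eq with ℚP.<-cmp y y′
... | tri< y<y′ _ _ = ⊥-elim (ℚP.<-irrefl eq (middle-mono-< x z y<y′))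
... | tri≈ _ y≡y′ _ = y≡y′
... | tri> _ _ y′<y = ⊥-elim (ℚP.<-irrefl (sym eq) (middle-mono-< x z y′<y))

⊆⇒diagonal-≤ : ∀ {n} {G₁ G₂ : Multigraph n} → (∀ x → H G₁ x → H G₂ x) →
               ∀ k → row G₁ k k ℚ.≤ row G₂ k k
⊆⇒diagonal-≤ {G₁ = G₁} {G₂} H₁⊆H₂ k = H-coordinate-≤ G₂ k (H₁⊆H₂ (row G₁ k) (row∈H G₁ k))

⊆⇒blockSum-≤ : ∀ {n} {G₁ G₂ : Multigraph (suc n)} → (∀ x → H G₁ x → H G₂ x) →
               ∀ {a k} → a ≢ k → blockSum G₁ a k ℚ.≤ blockSum G₂ a k
⊆⇒blockSum-≤ {G₁ = G₁} {G₂} H₁⊆H₂ {a} {k} a≢k =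
  subst (ℚ._≤ blockSum G₂ a k) (interchange (row G₁ a a) (row G₁ k a) (row G₁ a k) (row G₁ k k))
        (H-coordinateSum-≤ G₂ a≢k (H₁⊆H₂ (λ t → row G₁ a t ℚ.+ row G₁ k t) (rowSum∈H G₁ a≢k)))

H-determines-rows : ∀ {n} {G₁ G₂ : Multigraph (suc n)} →
                    SameSet (H G₁) (H G₂) → ∀ i j → row G₁ i j ≡ row G₂ i j
H-determines-rows {G₁ = G₁} {G₂} H₁≡H₂ i j = case i ≟ j of λ where
    (yes refl) → diagonal i
    (no  i≢j)  → middle-cancel (row G₁ i i) (row G₁ j j) (begin
      (row G₁ i i ℚ.+ row G₁ i j) ℚ.+ (row G₁ i j ℚ.+ row G₁ j j)
        ≡⟨ cong (λ q → (row G₁ i i ℚ.+ row G₁ i j) ℚ.+ (q ℚ.+ row G₁ j j)) (row-sym G₁ i j) ⟩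
      blockSum G₁ i j
        ≡⟨ ℚP.≤-antisym (⊆⇒blockSum-≤ H₁⊆H₂ i≢j) (⊆⇒blockSum-≤ H₂⊆H₁ i≢j) ⟩
      blockSum G₂ i j
        ≡⟨ cong₂ (λ p q → (p ℚ.+ row G₂ i j) ℚ.+ q)
                 (sym (diagonal i)) (cong₂ ℚ._+_ (row-sym G₂ j i) (sym (diagonal j))) ⟩
      (row G₁ i i ℚ.+ row G₂ i j) ℚ.+ (row G₂ i j ℚ.+ row G₁ j j) ∎)
  where
  H₁⊆H₂ : ∀ x → H G₁ x → H G₂ x
  H₁⊆H₂ x = Equivalence.to (H₁≡H₂ x)
  H₂⊆H₁ : ∀ x → H G₂ x → H G₁ x
  H₂⊆H₁ x = Equivalence.from (H₁≡H₂ x)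
  diagonal : ∀ k → row G₁ k k ≡ row G₂ k k
  diagonal k = ℚP.≤-antisym (⊆⇒diagonal-≤ H₁⊆H₂ k) (⊆⇒diagonal-≤ H₂⊆H₁ k)

H-cong : ∀ {n} {G₁ G₂ : Multigraph n} → (∀ i j → Laplacian G₁ i j ≡ Laplacian G₂ i j) →
         ∀ x → H G₁ x → H G₂ x
H-cong {G₁ = G₁} {G₂} Q₁≡Q₂ x (σ , λs , λs≥0 , Σλs≡1 , x≡) =
  σ , λs , λs≥0 , Σλs≡1 , (λ t → trans (x≡ t) (sumℚ-cong (λ i → cong (λs i ℚ.*_) (u₁≡u₂ i t))))
  where
  u₁≡u₂ : ∀ i t → u G₁ σ i t ≡ u G₂ σ i t
  u₁≡u₂ i t = sumℚ-cong (λ j →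
    cong (λ q → if ⌊ toℕ j ℕ.≤? toℕ i ⌋ then q ℚ./ 1 else 0ℚ) (Q₁≡Q₂ (σ ⟨$⟩ʳ j) t))

mainTheorem3 : (n : ℕ) → 1 ≤ n → (G₁ G₂ : Multigraph n) →
    Connected G₁ → Connected G₂ →
    SameSet (H G₁) (H G₂) ⇔ (∀ i j → Laplacian G₁ i j ≡ Laplacian G₂ i j)
mainTheorem3 zero    ()
mainTheorem3 (suc n) _ G₁ G₂ _ _ = mk⇔
  (λ H₁≡H₂ i j → row-injective G₁ G₂ i j (H-determines-rows H₁≡H₂ i j))
  (λ Q₁≡Q₂ x → mk⇔ (H-cong Q₁≡Q₂ x) (H-cong (λ i j → sym (Q₁≡Q₂ i j)) x))
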